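{- Let $C$ be a dendritic face complex with greatest element $\omega$, $n=\dim\omega$. Then for every $0\le k\le n$ the set $C_k\setminus\bigcup_{c\in C_{k+1}}\delta(c)$ has exactly one element.
   Context: A positive-to-one poset (POP) is a finite set $P$ with $\dim:P\to\mathbb{N}$ and binary relations $\prec^-,\prec^+$; $y\prec x$ means $y\prec^-x$ or $y\prec^+x$. Axioms: $y\prec x\Rightarrow\dim x=\dim y+1$; never both $y\prec^-x$ and $y\prec^+x$; every $x$ with $\dim x\ge1$ has exactly one $y$ with $y\prec^+x$, denoted $\gamma(x)$, and at least one $y$ with $y\prec^-x$. $\delta(x)=\{y:y\prec^-x\}$, $C_k=\dim^{ -1}(k)$; $\le$ is the reflexive-transitive closure of $\prec$. A dendritic face complex is a POP such that: it has a greatest element for $\le$; (oriented thinness) whenever $z\prec^{\beta}y\prec^{\alpha}x$ there is a unique $y'\ne y$ with $z\prec y'\prec x$, and writing $z\prec^{\beta'}y'\prec^{\alpha'}x$ the signs (as $\pm1$) satisfy $\alpha\beta=-\alpha'\beta'$; (acyclicity) $\delta(x)$ is a singleton if $\dim x=1$, nonempty if $\dim x\ge1$, and for $\dim x\ge1$ there are no $p\ge1$, $y_1,\dots,y_p\in\delta(x)$ with $\gamma(y_{i+1})\in\delta(y_i)$ ($1\le i<p$) and $\gamma(y_1)\in\delta(y_p)$. -}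

module Defs where

open import Data.Nat using (ℕ; zero; suc; _≤_)
open import Data.Fin using (Fin; inject₁; fromℕ) renaming (zero to fzero; suc to fsuc)
open import Data.Bool using (Bool; T)
open import Data.Sign using (Sign; opposite) renaming (_*_ to _*ₛ_)
open import Data.Product using (Σ; ∃; ∃!; _×_; _,_)
open import Data.Empty using (⊥)
open import Relation.Nullary using (¬_)
open import Relation.Binary.PropositionalEquality using (_≡_; _≢_)
open import Relation.Binary.Construct.Closure.ReflexiveTransitive using (Star)

-- A positive-to-one poset on the finite carrier Fin N.
-- minus y x = true  means  y ≺⁻ x ;  plus y x = true  means  y ≺⁺ x.
record POP : Set₁ where
  field
    N     : ℕ
    dim   : Fin N → ℕ
    minus : Fin N → Fin N → Bool
    plus  : Fin N → Fin N → Bool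

  _≺⁻_ : Fin N → Fin N → Set
  y ≺⁻ x = T (minus y x)

  _≺⁺_ : Fin N → Fin N → Set
  y ≺⁺ x = T (plus y x)

  rel : Sign → Fin N → Fin N → Set
  rel Sign.- y x = y ≺⁻ x
  rel Sign.+ y x = y ≺⁺ x

  data _≺_ (y x : Fin N) : Set where
    via⁻ : y ≺⁻ x → y ≺ x
    via⁺ : y ≺⁺ x → y ≺ x

  _≤P_ : Fin N → Fin N → Set
  _≤P_ = Star _≺_

  δ : Fin N → Fin N → Set
  δ x y = y ≺⁻ x

  C : ℕ → Fin N → Set
  C k x = dim x ≡ k

  -- "γ(b) ∈ δ(a)", i.e. the unique positive face of b is a negative face of a
  γ∈δ : Fin N → Fin N → Set
  γ∈δ b a = Σ (Fin N) λ g → (g ≺⁺ b) × (g ≺⁻ a)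

record IsPOP (P : POP) : Set where
  open POP P
  field
    dim-step    : ∀ {x y} → y ≺ x → dim x ≡ suc (dim y)
    not-both    : ∀ {x y} → ¬ ((y ≺⁻ x) × (y ≺⁺ x))
    unique-plus : ∀ x → 1 ≤ dim x → ∃! _≡_ (λ y → y ≺⁺ x)
    some-minus  : ∀ x → 1 ≤ dim x → ∃ (λ y → y ≺⁻ x)

record DeltaCycle (P : POP) (x : Fin (POP.N P)) : Set where
  open POP P
  field
    m      : ℕ
    ys     : Fin (suc m) → Fin N
    in-δ   : ∀ i → ys i ≺⁻ x
    linked : ∀ (i : Fin m) → γ∈δ (ys (fsuc i)) (ys (inject₁ i))
    closes : γ∈δ (ys fzero) (ys (fromℕ m))

record IsDendriticFaceComplex (P : POP) : Set where
  open POP P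
  field
    isPOP    : IsPOP P
    greatest : Σ (Fin N) λ ω → ∀ x → x ≤P ω
    oriented-thin :
      ∀ α β {x y z} → rel β z y → rel α y x →
      Σ (Fin N) λ y' → (y' ≢ y) × (z ≺ y') × (y' ≺ x)
        × (∀ y'' → y'' ≢ y → z ≺ y'' → y'' ≺ x → y'' ≡ y')
        × (∀ α' β' → rel β' z y' → rel α' y' x → α *ₛ β ≡ opposite (α' *ₛ β'))
    dim1-singleton : ∀ x → dim x ≡ 1 → ∃! _≡_ (λ y → y ≺⁻ x)
    δ-nonempty     : ∀ x → 1 ≤ dim x → ∃ (λ y → y ≺⁻ x)
    acyclic        : ∀ x → 1 ≤ dim x → ¬ DeltaCycle P x

{-# OPTIONS --safe #-}
-- The maximal element of dimension k is γⁿ⁻ᵏ(ω). Oriented thinness says that the two elements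
-- between z and x in a diamond carry opposite orientations; acyclicity says that a descent through
-- δ(x), stepping from f to some y with γ(y) ∈ δ(f), must stop, since after N steps the pigeonhole
-- principle would close a forbidden cycle. Such descents show that every face of x of codimension
-- ≥ 3 lies below γ(x), so everything of dimension ≤ k lies below the iterate T = γⁿ⁻ᵏ⁻²(ω), and a
-- maximal k-element below T is forced to be γ(γ(T)). Conversely, for the iterate X of dimension
-- k + 3, every (k+1)-element lies below X, and a descent through δ(X) shows that γ³(X) is an input
-- face of none of them: the descent can only stop at a facet of γ(X), and γ³(X) = γ²(γ(X)) is an
-- input face of no facet of γ(X) by the diamond axiom.
module Submission where

open import Defs
open import Data.Nat using (ℕ; zero; suc; _≤_; _<_; _+_; z≤n; s≤s)
open import Data.Nat.Properties
  using (≤-refl; ≤-trans; ≤-reflexive; <-≤-trans; <⇒≤; <-irrefl; 1+n≰n; ≤-pred; n<1+n;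
         suc-injective; +-comm; +-monoˡ-≤; m≤n+m; m+n≤o⇒n≤o; m≤n⇒m<n∨m≡n; m≤n⇒∃[o]m+o≡n)
open import Data.Fin using (Fin; toℕ; inject₁; fromℕ) renaming (zero to fzero; suc to fsuc)
open import Data.Fin.Properties using (pigeonhole; toℕ<n; toℕ-inject₁; toℕ-fromℕ)
open import Data.Product using (∃!; _×_; Σ; _,_; proj₁; proj₂)
open import Data.Sum using (_⊎_; inj₁; inj₂; map₂)
open import Data.Empty using (⊥; ⊥-elim)
open import Data.Sign using (Sign; opposite) renaming (_*_ to _*ₛ_)
open import Function using (_∘_)
open import Relation.Nullary using (¬_)
open import Relation.Binary.PropositionalEquality using (_≡_; _≢_; refl; sym; trans; cong; subst; subst₂)
open import Relation.Binary.Construct.Closure.ReflexiveTransitive using (ε; _◅_; _◅◅_)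

module _ {N : ℕ} (R : Fin N → Fin N → Set) where

  record Cycle : Set where
    field
      m      : ℕ
      ys     : Fin (suc m) → Fin N
      linked : ∀ (i : Fin m) → R (ys (fsuc i)) (ys (inject₁ i))
      closes : R (ys fzero) (ys (fromℕ m))

  Walk : ℕ → Fin N → Set
  Walk L f = Σ (ℕ → Fin N) λ v → v 0 ≡ f × (∀ l → l < L → R (v (suc l)) (v l))

  closed-walk⇒cycle : (v : ℕ → Fin N) (m : ℕ) →
    (∀ l → l ≤ m → R (v (suc l)) (v l)) → v (suc m) ≡ v 0 → Cycle
  closed-walk⇒cycle v m step closed = record
    { m = m ; ys = v ∘ toℕ ; linked = linked ; closes = closes }
    where
      linked : ∀ (i : Fin m) → R (v (suc (toℕ i))) (v (toℕ (inject₁ i)))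
      linked i rewrite toℕ-inject₁ i = step (toℕ i) (<⇒≤ (toℕ<n i))
      closes : R (v 0) (v (toℕ (fromℕ m)))
      closes rewrite toℕ-fromℕ m = subst (λ y → R y (v m)) closed (step m ≤-refl)

  walk⇒cycle : ∀ {f} → Walk N f → Cycle
  walk⇒cycle (v , _ , step) with pigeonhole (n<1+n N) (v ∘ toℕ)
  ... | i , j , i<j , vi≡vj with m≤n⇒∃[o]m+o≡n i<j
  ... | m , 1+i+m≡j = closed-walk⇒cycle (λ l → v (l + toℕ i)) m step' closed
    where
      1+m+i≡j : suc (m + toℕ i) ≡ toℕ j
      1+m+i≡j = trans (cong suc (+-comm m (toℕ i))) 1+i+m≡j
      step' : ∀ l → l ≤ m → R (v (suc (l + toℕ i))) (v (l + toℕ i))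
      step' l l≤m = step (l + toℕ i)
        (≤-trans (s≤s (+-monoˡ-≤ (toℕ i) l≤m)) (subst (_≤ N) (sym 1+m+i≡j) (≤-pred (toℕ<n j))))
      closed : v (suc (m + toℕ i)) ≡ v (toℕ i)
      closed = trans (cong v 1+m+i≡j) (sym vi≡vj)

  module _ {S : Fin N → Set} {G : Set} (step : ∀ f → S f → G ⊎ Σ (Fin N) λ y → R y f × S y) where

    stop-or-walk : ∀ L f → S f → G ⊎ Walk L f
    stop-or-walk zero f _ = inj₂ ((λ _ → f) , refl , λ _ ())
    stop-or-walk (suc L) f s with step f s
    ... | inj₁ g = inj₁ g
    ... | inj₂ (y , r , sy) with stop-or-walk L y sy
    ... | inj₁ g = inj₁ g
    ... | inj₂ (v , refl , links) = inj₂ (v' , refl , links')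
      where
        v' : ℕ → Fin N
        v' zero = f
        v' (suc l) = v l
        links' : ∀ l → l < suc L → R (v' (suc l)) (v' l)
        links' zero _ = r
        links' (suc l) l<L = links l (≤-pred l<L)

    stop-or-cycle : ∀ f → S f → G ⊎ Cycle
    stop-or-cycle f s = map₂ walk⇒cycle (stop-or-walk N f s)

module FaceComplex (P : POP) (D : IsDendriticFaceComplex P) where
  open POP P
  open IsDendriticFaceComplex D
  open IsPOP isPOP

  ≺⇒dim< : ∀ {y x} → y ≺ x → dim y < dim x
  ≺⇒dim< yx = ≤-reflexive (sym (dim-step yx))

  ≺⇒1≤dim : ∀ {y x} → y ≺ x → 1 ≤ dim x
  ≺⇒1≤dim yx = ≤-trans (s≤s z≤n) (≺⇒dim< yx)

  dim-facet : ∀ {y x n} → y ≺ x → dim x ≡ suc n → dim y ≡ n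
  dim-facet yx eq = suc-injective (trans (sym (dim-step yx)) eq)

  dim-facet-≥ : ∀ {y x n} → y ≺ x → suc n ≤ dim x → n ≤ dim y
  dim-facet-≥ yx n<dim = ≤-pred (subst (_ ≤_) (dim-step yx) n<dim)

  ≤P⇒dim≤ : ∀ {z x} → z ≤P x → dim z ≤ dim x
  ≤P⇒dim≤ ε = ≤-refl
  ≤P⇒dim≤ (zy ◅ yx) = ≤-trans (<⇒≤ (≺⇒dim< zy)) (≤P⇒dim≤ yx)

  ≤P∧dim≡⇒≡ : ∀ {z x} → z ≤P x → dim z ≡ dim x → z ≡ x
  ≤P∧dim≡⇒≡ ε _ = refl
  ≤P∧dim≡⇒≡ (zy ◅ yx) eq = ⊥-elim (<-irrefl eq (<-≤-trans (≺⇒dim< zy) (≤P⇒dim≤ yx)))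

  ≤P⇒≡⊎≤P-facet : ∀ {z x} → z ≤P x → z ≡ x ⊎ Σ (Fin N) λ w → z ≤P w × w ≺ x
  ≤P⇒≡⊎≤P-facet ε = inj₁ refl
  ≤P⇒≡⊎≤P-facet (zy ◅ yx) with ≤P⇒≡⊎≤P-facet yx
  ... | inj₁ refl = inj₂ (_ , ε , zy)
  ... | inj₂ (w , yw , wx) = inj₂ (w , zy ◅ yw , wx)

  ≤P⇒≤P-facet : ∀ {z x} → z ≤P x → dim z < dim x → Σ (Fin N) λ w → z ≤P w × w ≺ x
  ≤P⇒≤P-facet zx z<x with ≤P⇒≡⊎≤P-facet zx
  ... | inj₁ refl = ⊥-elim (<-irrefl refl z<x)
  ... | inj₂ facet = facet

  ≤P-codim1⇒≺ : ∀ {z x} → z ≤P x → dim x ≡ suc (dim z) → z ≺ x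
  ≤P-codim1⇒≺ zx eq with ≤P⇒≤P-facet zx (≤-reflexive (sym eq))
  ... | w , zw , wx with ≤P∧dim≡⇒≡ zw (sym (dim-facet wx eq))
  ... | refl = wx

  ≤P-codim2⇒≺≺ : ∀ {z x} → z ≤P x → dim x ≡ 2 + dim z → Σ (Fin N) λ w → z ≺ w × w ≺ x
  ≤P-codim2⇒≺≺ zx eq with ≤P⇒≤P-facet zx (<⇒≤ (≤-reflexive (sym eq)))
  ... | w , zw , wx = w , ≤P-codim1⇒≺ zw (dim-facet wx eq) , wx

  γ-unique : ∀ {x y y'} → y ≺⁺ x → y' ≺⁺ x → y ≡ y'
  γ-unique {x} yx y'x with unique-plus x (≺⇒1≤dim (via⁺ yx))
  ... | _ , _ , unique = trans (sym (unique yx)) (unique y'x)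

  γ-face : ∀ {x n} → dim x ≡ suc n → Σ (Fin N) λ g → g ≺⁺ x × dim g ≡ n
  γ-face {x} eq with unique-plus x (subst (1 ≤_) (sym eq) (s≤s z≤n))
  ... | g , gx , _ = g , gx , dim-facet (via⁺ gx) eq

  ≺⇒rel : ∀ {y x} → y ≺ x → Σ Sign λ s → rel s y x
  ≺⇒rel (via⁻ yx) = Sign.- , yx
  ≺⇒rel (via⁺ yx) = Sign.+ , yx

  rel⇒≺ : ∀ s {y x} → rel s y x → y ≺ x
  rel⇒≺ Sign.- = via⁻
  rel⇒≺ Sign.+ = via⁺

  diamond : ∀ α β {x y z} → rel β z y → rel α y x →
    Σ (Fin N) λ y' → y' ≢ y × Σ Sign λ α' → Σ Sign λ β' →
      rel β' z y' × rel α' y' x × α *ₛ β ≡ opposite (α' *ₛ β')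
  diamond α β zy yx with oriented-thin α β zy yx
  ... | y' , y'≢y , zy' , y'x , _ , signs with ≺⇒rel zy' | ≺⇒rel y'x
  ... | β' , zy'ˢ | α' , y'xˢ = y' , y'≢y , α' , β' , zy'ˢ , y'xˢ , signs α' β' zy'ˢ y'xˢ

  diamond-opposite : ∀ α β α' β' {x y y' z} → rel β z y → rel α y x →
    rel β' z y' → rel α' y' x → y' ≢ y → α *ₛ β ≡ opposite (α' *ₛ β')
  diamond-opposite α β α' β' zy yx zy' y'x y'≢y with oriented-thin α β zy yx
  ... | _ , _ , _ , _ , unique , signs with unique _ y'≢y (rel⇒≺ β' zy') (rel⇒≺ α' y'x)
  ... | refl = signs α' β' zy' y'x

  γγ∉δ-facet : ∀ {t h g c} → t ≺⁺ h → h ≺⁺ g → c ≺ g → ¬ t ≺⁻ c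
  γγ∉δ-facet th hg (via⁺ cg) tc = not-both (tc , subst (_ ≺⁺_) (γ-unique hg cg) th)
  γγ∉δ-facet th hg (via⁻ cg) tc
    with diamond-opposite Sign.+ Sign.+ Sign.- Sign.- th hg tc cg (λ { refl → not-both (tc , th) })
  ... | ()

  ∉δ-facets⇒γγ : ∀ {z x} → z ≤P x → dim x ≡ 2 + dim z → (∀ c → c ≺ x → ¬ z ≺⁻ c) →
    Σ (Fin N) λ g → z ≺⁺ g × g ≺⁺ x
  ∉δ-facets⇒γγ zx eq ∉δ with ≤P-codim2⇒≺≺ zx eq
  ... | w , via⁻ zw , wx = ⊥-elim (∉δ w wx zw)
  ... | w , via⁺ zw , via⁺ wx = w , zw , wx
  ... | w , via⁺ zw , via⁻ wx with diamond Sign.- Sign.+ zw wx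
  ... | w' , _ , Sign.+ , Sign.+ , zw' , w'x , _ = w' , zw' , w'x
  ... | w' , _ , Sign.- , Sign.- , zw' , w'x , _ = ⊥-elim (∉δ w' (via⁻ w'x) zw')
  ... | _ , _ , Sign.+ , Sign.- , _ , _ , ()
  ... | _ , _ , Sign.- , Sign.+ , _ , _ , ()

  δ-of-facet⇒δ-of-δ : ∀ {t c f} → t ≺⁻ c → c ≺ f → Σ (Fin N) λ c' → t ≺⁻ c' × c' ≺⁻ f
  δ-of-facet⇒δ-of-δ tc (via⁻ cf) = _ , tc , cf
  δ-of-facet⇒δ-of-δ tc (via⁺ cf) with diamond Sign.+ Sign.- tc cf
  ... | c' , _ , Sign.- , Sign.- , tc' , c'f , _ = c' , tc' , c'f
  ... | c' , c'≢c , Sign.+ , Sign.+ , _ , c'f , _ = ⊥-elim (c'≢c (γ-unique c'f cf))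
  ... | _ , _ , Sign.+ , Sign.- , _ , _ , ()
  ... | _ , _ , Sign.- , Sign.+ , _ , _ , ()

  ≤P-codim≥2⇒≤P-δ : ∀ {z f} → z ≤P f → 2 + dim z ≤ dim f → Σ (Fin N) λ w → w ≺⁻ f × z ≤P w
  ≤P-codim≥2⇒≤P-δ zf codim with ≤P⇒≤P-facet zf (<⇒≤ codim)
  ... | w , zw , via⁻ wf = w , wf , zw
  ... | w , zw , via⁺ wf with ≤P⇒≤P-facet zw (dim-facet-≥ (via⁺ wf) codim)
  ... | v , zv , vw with ≺⇒rel vw
  ... | β , vwˢ with diamond Sign.+ β vwˢ wf
  ... | w' , _ , Sign.- , β' , vw' , w'f , _ = w' , w'f , zv ◅◅ rel⇒≺ β' vw' ◅ ε
  ... | w' , w'≢w , Sign.+ , _ , _ , w'f , _ = ⊥-elim (w'≢w (γ-unique w'f wf))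

  Linked : Fin N → Fin N → Fin N → Set
  Linked x y f = y ≺⁻ x × γ∈δ y f

  δδ-diamond : ∀ {w f x g} → w ≺⁻ f → f ≺⁻ x → g ≺⁺ x →
    w ≺⁻ g ⊎ Σ (Fin N) λ y → Linked x y f × w ≺⁺ y
  δδ-diamond wf fx gx with diamond Sign.- Sign.- wf fx
  ... | y , _ , Sign.+ , Sign.- , wy , yx , _ = inj₁ (subst (_ ≺⁻_) (γ-unique yx gx) wy)
  ... | y , _ , Sign.- , Sign.+ , wy , yx , _ = inj₂ (y , (yx , _ , wy , wf) , wy)
  ... | _ , _ , Sign.+ , Sign.+ , _ , _ , ()
  ... | _ , _ , Sign.- , Sign.- , _ , _ , ()

  cycle⇒δ-cycle : ∀ {x} → Cycle (Linked x) → DeltaCycle P x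
  cycle⇒δ-cycle {x} c = record
    { m = m ; ys = ys ; in-δ = in-δ ; linked = λ i → proj₂ (linked i) ; closes = proj₂ closes }
    where
      open Cycle c
      in-δ : ∀ i → ys i ≺⁻ x
      in-δ fzero = proj₁ closes
      in-δ (fsuc i) = proj₁ (linked i)

  δ-descent : ∀ {x} {S : Fin N → Set} {G : Set} → 1 ≤ dim x →
    (∀ f → S f → G ⊎ Σ (Fin N) λ y → Linked x y f × S y) → ∀ f → S f → G
  δ-descent {x} 1≤dim step f s with stop-or-cycle (Linked x) step f s
  ... | inj₁ g = g
  ... | inj₂ c = ⊥-elim (acyclic x 1≤dim (cycle⇒δ-cycle c))

  ≤P-codim≥3⇒≤P-γ : ∀ {z g x} → g ≺⁺ x → z ≤P x → 3 + dim z ≤ dim x → z ≤P g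
  ≤P-codim≥3⇒≤P-γ {z} {g} {x} gx zx codim with ≤P⇒≤P-facet zx (m+n≤o⇒n≤o 2 codim)
  ... | y , zy , via⁺ yx = subst (z ≤P_) (γ-unique yx gx) zy
  ... | y , zy , via⁻ yx = δ-descent (≺⇒1≤dim (via⁺ gx)) step y (yx , zy)
    where
      step : ∀ f → f ≺⁻ x × z ≤P f → z ≤P g ⊎ Σ (Fin N) λ y' → Linked x y' f × y' ≺⁻ x × z ≤P y'
      step f (fx , zf) with ≤P-codim≥2⇒≤P-δ zf (dim-facet-≥ (via⁻ fx) codim)
      ... | w , wf , zw with δδ-diamond wf fx gx
      ... | inj₁ wg = inj₁ (zw ◅◅ via⁻ wg ◅ ε)
      ... | inj₂ (y' , link , wy') = inj₂ (y' , link , proj₁ link , zw ◅◅ via⁺ wy' ◅ ε)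

  γγγ∉δ-codim2 : ∀ {t h g x c} → t ≺⁺ h → h ≺⁺ g → g ≺⁺ x → c ≤P x → dim x ≡ 2 + dim c → ¬ t ≺⁻ c
  γγγ∉δ-codim2 {t} {x = x} th hg gx cx codim tc with ≤P-codim2⇒≺≺ cx codim
  ... | y , cy , via⁺ yx = γγ∉δ-facet th hg (subst (_ ≺_) (γ-unique yx gx) cy) tc
  ... | y , cy , via⁻ yx = δ-descent (≺⇒1≤dim (via⁺ gx)) step y (yx , δ-of-facet⇒δ-of-δ tc cy)
    where
      S : Fin N → Set
      S f = f ≺⁻ x × Σ (Fin N) λ c' → t ≺⁻ c' × c' ≺⁻ f
      step : ∀ f → S f → ⊥ ⊎ Σ (Fin N) λ y' → Linked x y' f × S y'
      step f (fx , c' , tc' , c'f) with δδ-diamond c'f fx gx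
      ... | inj₁ c'g = inj₁ (γγ∉δ-facet th hg (via⁻ c'g) tc')
      ... | inj₂ (y' , link , c'y') =
        inj₂ (y' , link , proj₁ link , δ-of-facet⇒δ-of-δ tc' (via⁺ c'y'))

  ≤P-iterated-γ : ∀ {x m} → m ≤ dim x →
    Σ (Fin N) λ T → dim T ≡ m × (∀ z → z ≤P x → 2 + dim z ≤ m → z ≤P T)
  ≤P-iterated-γ {m = m} m≤dim with m≤n⇒∃[o]m+o≡n m≤dim
  ... | d , m+d≡dim = descend d (trans (sym m+d≡dim) (+-comm m d))
    where
      descend : ∀ d {x} → dim x ≡ d + m →
        Σ (Fin N) λ T → dim T ≡ m × (∀ z → z ≤P x → 2 + dim z ≤ m → z ≤P T)
      descend zero {x} eq = x , eq , λ _ zx _ → zx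
      descend (suc d) eq with γ-face eq
      ... | g , gx , dim-g with descend d dim-g
      ... | T , dim-T , below-T = T , dim-T , λ z zx codim →
        below-T z (≤P-codim≥3⇒≤P-γ gx zx
          (subst (3 + dim z ≤_) (sym eq) (s≤s (≤-trans codim (m≤n+m m d))))) codim

  Maximal : ℕ → Fin N → Set
  Maximal k x = C k x × (∀ c → C (suc k) c → ¬ δ c x)

  module _ (ω : Fin N) (top : ∀ x → x ≤P ω) where

    maximal-unique : ∀ {k y y'} → k ≤ dim ω → Maximal k y → Maximal k y' → y ≡ y'
    maximal-unique {k} k≤n max-y max-y' with m≤n⇒m<n∨m≡n k≤n
    ... | inj₂ k≡n = trans (is-ω max-y) (sym (is-ω max-y'))
      where
        is-ω : ∀ {z} → Maximal k z → z ≡ ω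
        is-ω {z} (dim-z , _) = ≤P∧dim≡⇒≡ (top z) (trans dim-z k≡n)
    ... | inj₁ k<n with m≤n⇒m<n∨m≡n k<n
    ... | inj₂ 1+k≡n = γ-unique (γ-of-ω max-y) (γ-of-ω max-y')
      where
        γ-of-ω : ∀ {z} → Maximal k z → z ≺⁺ ω
        γ-of-ω {z} (dim-z , max-z)
          with ≤P-codim1⇒≺ (top z) (trans (sym 1+k≡n) (cong suc (sym dim-z)))
        ... | via⁻ zω = ⊥-elim (max-z ω (sym 1+k≡n) zω)
        ... | via⁺ zω = zω
    ... | inj₁ 2+k≤n with ≤P-iterated-γ 2+k≤n
    ... | T , dim-T , below-T with γγ-of-T max-y | γγ-of-T max-y'
      where
        γγ-of-T : ∀ {z} → Maximal k z → Σ (Fin N) λ g → z ≺⁺ g × g ≺⁺ T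
        γγ-of-T {z} (dim-z , max-z) =
          ∉δ-facets⇒γγ (below-T z (top z) (≤-reflexive (cong (2 +_) dim-z)))
            (trans dim-T (cong (2 +_) (sym dim-z))) (λ c cT → max-z c (dim-facet cT dim-T))
    ... | g , yg , gT | g' , y'g' , g'T rewrite γ-unique gT g'T = γ-unique yg y'g'

    maximal-exists : ∀ {k} → k ≤ dim ω → Σ (Fin N) (Maximal k)
    maximal-exists {k} k≤n with m≤n⇒m<n∨m≡n k≤n
    ... | inj₂ k≡n = ω , sym k≡n , λ c dim-c _ →
      1+n≰n (subst₂ _≤_ dim-c (sym k≡n) (≤P⇒dim≤ (top c)))
    ... | inj₁ k<n with m≤n⇒m<n∨m≡n k<n
    ... | inj₂ 1+k≡n with γ-face (sym 1+k≡n)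
    ... | g , gω , dim-g = g , dim-g , λ c dim-c gc →
      not-both (subst (g ≺⁻_) (≤P∧dim≡⇒≡ (top c) (trans dim-c 1+k≡n)) gc , gω)
    maximal-exists {k} k≤n | inj₁ k<n | inj₁ 2+k≤n with m≤n⇒m<n∨m≡n 2+k≤n
    ... | inj₂ 2+k≡n with γ-face (sym 2+k≡n)
    ... | g , gω , dim-g with γ-face dim-g
    ... | t , tg , dim-t = t , dim-t , λ c dim-c →
      γγ∉δ-facet tg gω (≤P-codim1⇒≺ (top c) (trans (sym 2+k≡n) (cong suc (sym dim-c))))
    maximal-exists {k} k≤n | inj₁ k<n | inj₁ 2+k≤n | inj₁ 3+k≤n with ≤P-iterated-γ 3+k≤n
    ... | X , dim-X , below-X with γ-face dim-X
    ... | g , gX , dim-g with γ-face dim-g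
    ... | h , hg , dim-h with γ-face dim-h
    ... | t , th , dim-t = t , dim-t , λ c dim-c →
      γγγ∉δ-codim2 th hg gX (below-X c (top c) (≤-reflexive (cong (2 +_) dim-c)))
        (trans dim-X (cong (2 +_) (sym dim-c)))

    maximal-∃! : ∀ k → k ≤ dim ω → ∃! _≡_ (Maximal k)
    maximal-∃! k k≤n with maximal-exists k≤n
    ... | x , max-x = x , max-x , maximal-unique k≤n max-x

mainTheorem10 : (P : POP) → IsDendriticFaceComplex P →
    (ω : Fin (POP.N P)) → (∀ x → POP._≤P_ P x ω) →
    ∀ k → k ≤ POP.dim P ω →
    ∃! _≡_ (λ x → POP.C P k x × (∀ c → POP.C P (suc k) c → ¬ POP.δ P c x))
mainTheorem10 P D = FaceComplex.maximal-∃! P D
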